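{- For every flip class $[\sigma]\in\mathcal{FL}^{(B)}_n\cup\mathcal{FL}^{(D)}_n$, $\mathsf{emp}(\phi_F([\sigma]))=n-2\cdot\mathsf{spk}([\sigma])+1$.
   Context: Signed permutations of $[n]$ in window notation $\sigma=\sigma_1\cdots\sigma_n$ (entries in $\{\pm1,\dots,\pm n\}$, absolute values a permutation of $[n]$). For $1\le k\le n$, $\sigma_k\cdots\sigma_1\sigma_{k+1}\cdots\sigma_n$ is a flip of $\sigma$ if $k=n$ or $|\sigma_{k+1}|<\min\{|\sigma_i|:i\le k\}$; flip equivalence is generated by flips, classes $[\sigma]$. Signed maximum: for a nonempty word $\sigma$ of nonzero integers with distinct absolute values, write $\sigma=\sigma_L\hat\sigma\sigma_R$ with $|\hat\sigma|=\min|\sigma|$; (1) if $\sigma_L,\sigma_R$ empty, $\mathsf{smax}(\sigma)=\hat\sigma$; (2) if only $\sigma_L$ is empty: $\hat\sigma$ if $\hat\sigma>0$, else $\mathsf{smax}(\sigma_R)$; (3) if only $\sigma_R$ is empty: $\hat\sigma$ if $\hat\sigma>0$, else $\mathsf{smax}(\sigma_L)$; (4) both nonempty, $\hat\sigma>0$: $\mathsf{smax}(\sigma_L)$ if $\min|\sigma_L|>\min|\sigma_R|$, else $\mathsf{smax}(\sigma_R)$; (5) both nonempty, $\hat\sigma<0$: $\mathsf{smax}(\sigma_L)$ if $\min|\sigma_L|<\min|\sigma_R|$, else $\mathsf{smax}(\sigma_R)$. It is constant on flip classes. $\mathcal{FL}^{(B)}_n$ ($\mathcal{FL}^{(D)}_n$):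 classes of signed permutations of $[n]$ with positive (negative) signed maximum. $\mathsf{spk}(\sigma)=\#\{i:\sigma_i<0,\ |\sigma_{i-1}|<|\sigma_i|>|\sigma_{i+1}|\}$ with $\sigma_0=\sigma_{n+1}=0$; constant on flip classes, $\mathsf{spk}([\sigma])=\mathsf{spk}(\sigma)$. Tree $\tau(\sigma)$ for a word $\sigma$ of nonzero integers with distinct absolute values: $\tau(\emptyset)$ is an empty (unlabelled) leaf. Otherwise write $\sigma=\sigma_L\sigma_i\sigma_R$ with $|\sigma_i|=\min|\sigma|$; the root is labelled $|\sigma_i|$. If $\sigma_L,\sigma_R$ are both empty: the root is a labelled leaf if $\sigma_i<0$, and has two empty leaf children if $\sigma_i>0$. Otherwise, with $\min(\emptyset)=+\infty$: if $\sigma_i>0$, the one of $\tau(\sigma_L),\tau(\sigma_R)$ whose word has the smaller minimum absolute value is the left subtree and the other the right subtree; if $\sigma_i<0$, the one whose word has the smaller minimum absolute value is the right subtree and the other the left subtree. $\tau(\sigma)$ is the same for all $\sigma$ in a flip class, and $\phi_F([\sigma]):=\tau(\sigma)$. $\mathsf{emp}(\tau)$ is the number of empty leaves of $\tau$. -}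

module Defs where

open import Data.Nat as ℕ using (ℕ; zero; suc; _+_; _*_)
open import Data.Integer as ℤ using (ℤ; +_; +[1+_]; -[1+_]; ∣_∣)
open import Data.List using (List; []; _∷_; length; map; upTo)
open import Data.List.Relation.Binary.Permutation.Propositional using (_↭_)
open import Data.Bool using (Bool; true; false; if_then_else_; _∧_)
open import Data.Product using (_×_; _,_)
open import Relation.Nullary.Decidable using (⌊_⌋)

-- A signed permutation of [n] in window notation: a word of integers whose
-- absolute values form a permutation of 1,...,n.
IsSignedPerm : ℕ → List ℤ → Set
IsSignedPerm n σ = map ∣_∣ σ ↭ map suc (upTo n)

isPos : ℤ → Bool
isPos +[1+ _ ] = true
isPos _        = false

isNeg : ℤ → Bool
isNeg -[1+ _ ] = true
isNeg _        = false

_<ᵇ_ : ℕ → ℕ → Bool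
m <ᵇ n = ⌊ m ℕ.<? n ⌋

-- split a nonempty word x ∷ xs as σ_L σ̂ σ_R with |σ̂| minimal
splitMin : ℤ → List ℤ → List ℤ × ℤ × List ℤ
splitMin x [] = [] , x , []
splitMin x (y ∷ ys) with splitMin y ys
... | L , m , R = if ∣ x ∣ <ᵇ ∣ m ∣ then ([] , x , y ∷ ys) else (x ∷ L , m , R)

-- min |·| of a word, with min(∅) = +∞ (represented as false = "infinite")
-- minLt L R  decides  min|L| < min|R|  with the convention min(∅) = +∞
minAbs : List ℤ → ℕ
minAbs [] = 0
minAbs (x ∷ xs) with splitMin x xs
... | _ , m , _ = ∣ m ∣

minLt : List ℤ → List ℤ → Bool
minLt []       _        = false
minLt (_ ∷ _)  []       = true
minLt (x ∷ xs) (y ∷ ys) = minAbs (x ∷ xs) <ᵇ minAbs (y ∷ ys)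

-- signed maximum; fuel-based recursion (fuel = length of the word suffices);
-- value 0 on the empty word (where smax is undefined).
smaxF : ℕ → List ℤ → ℤ
smaxF _ [] = + 0
smaxF zero (_ ∷ _) = + 0
smaxF (suc f) (x ∷ xs) with splitMin x xs
... | [] , m , [] = m
... | [] , m , R@(_ ∷ _) = if isPos m then m else smaxF f R
... | L@(_ ∷ _) , m , [] = if isPos m then m else smaxF f L
... | L@(_ ∷ _) , m , R@(_ ∷ _) =
  if isPos m
  then (if minLt R L then smaxF f L else smaxF f R)
  else (if minLt L R then smaxF f L else smaxF f R)

smax : List ℤ → ℤ
smax σ = smaxF (length σ) σ

-- signed peaks, with σ₀ = σ_{n+1} = 0
nextAbs : List ℤ → ℕ
nextAbs [] = 0
nextAbs (y ∷ _) = ∣ y ∣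

spkGo : ℕ → List ℤ → ℕ
spkGo p [] = 0
spkGo p (x ∷ xs) =
  (if isNeg x ∧ (p <ᵇ ∣ x ∣) ∧ (nextAbs xs <ᵇ ∣ x ∣) then 1 else 0) + spkGo ∣ x ∣ xs

spk : List ℤ → ℕ
spk σ = spkGo 0 σ

data Tree : Set where
  emptyLeaf : Tree
  labLeaf   : ℕ → Tree
  node      : ℕ → Tree → Tree → Tree

tauF : ℕ → List ℤ → Tree
tauF _ [] = emptyLeaf
tauF zero (_ ∷ _) = emptyLeaf
tauF (suc f) (x ∷ xs) with splitMin x xs
... | [] , m , [] = if isPos m then node ∣ m ∣ emptyLeaf emptyLeaf else labLeaf ∣ m ∣
... | L , m , R =
  if isPos m
  then (if minLt L R then node ∣ m ∣ (tauF f L) (tauF f R) else node ∣ m ∣ (tauF f R) (tauF f L))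
  else (if minLt L R then node ∣ m ∣ (tauF f R) (tauF f L) else node ∣ m ∣ (tauF f L) (tauF f R))

τ : List ℤ → Tree
τ σ = tauF (length σ) σ

phiF : List ℤ → Tree
phiF = τ

emp : Tree → ℕ
emp emptyLeaf    = 1
emp (labLeaf _)  = 0
emp (node _ l r) = emp l + emp r

-- Removing the letter of smallest absolute value splits a word σ = σ_L σ̂ σ_R into two shorter
-- words, and τ(σ) is a node over τ(σ_L) and τ(σ_R) (in some order), so emp is additive.  Since
-- |σ̂| is below its neighbours, σ̂ is never a peak and the last letter of σ_L stays a peak
-- exactly when it was one at the end of σ_L, so spk is additive as well.  Hence
-- emp τ(σ) + 2 spk(σ) − (|σ| + 1) is additive under the split, and it vanishes on single
-- letters: a positive letter gives a node with two empty leaves and no peak, a negative one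
-- a labelled leaf and one signed peak.  So the identity holds for every signed permutation,
-- whatever the sign of its signed maximum.
module Submission where

open import Defs
open import Data.Nat using (ℕ; _*_)
open import Data.Integer using (ℤ; +_; _-_; _+_; _<_)
open import Data.List using (List)
open import Data.Sum using (_⊎_; inj₁; inj₂)
open import Relation.Binary.PropositionalEquality using (_≡_)

open import Data.Nat as ℕ using (zero; suc; _≤_; z≤n)
import Data.Nat.Properties as ℕ
open import Data.Integer using (+[1+_]; -[1+_]; ∣_∣)
import Data.Integer.Tactic.RingSolver as ℤ-Ring
open import Data.List using ([]; _∷_; _++_; length; map; upTo)
import Data.List.Properties as List
open import Data.List.Relation.Unary.All as All using (All; []; _∷_)
import Data.List.Relation.Unary.All.Properties as All
open import Data.List.Relation.Unary.AllPairs as AllPairs using (AllPairs; []; _∷_)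
import Data.List.Relation.Unary.AllPairs.Properties as AllPairs
import Data.List.Relation.Unary.Unique.Propositional.Properties as Unique
open import Data.List.Relation.Binary.Permutation.Propositional using (↭-sym; ↭⇒↭ₛ)
open import Data.List.Relation.Binary.Permutation.Propositional.Properties
  using (↭-length; All-resp-↭)
import Data.List.Relation.Binary.Permutation.Setoid.Properties as Perm
open import Data.Bool using (Bool; true; false; if_then_else_; _∧_)
open import Data.Bool.Properties using (∧-zeroʳ)
open import Data.Product using (_×_; _,_; proj₁; proj₂)
open import Data.Empty using (⊥-elim)
open import Function using (_on_)
open import Relation.Nullary using (¬_; yes; no)
open import Relation.Nullary.Decidable using (isYes≗does; dec-true; dec-false)
open import Relation.Binary.Core using (Rel)
open import Relation.Binary.PropositionalEquality
  using (refl; sym; trans; cong; cong₂; subst; _≢_; setoid; module ≡-Reasoning)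

_≉_ : ℤ → ℤ → Set
_≉_ = _≢_ on ∣_∣

_<ₐ_ : ℤ → ℤ → Set
_<ₐ_ = ℕ._<_ on ∣_∣

NonZeroAbs : ℤ → Set
NonZeroAbs x = ∣ x ∣ ≢ 0

<ᵇ-true : ∀ {m n} → m ℕ.< n → (m <ᵇ n) ≡ true
<ᵇ-true {m} {n} m<n = trans (isYes≗does (m ℕ.<? n)) (dec-true (m ℕ.<? n) m<n)

<ᵇ-false : ∀ {m n} → n ≤ m → (m <ᵇ n) ≡ false
<ᵇ-false {m} {n} n≤m = trans (isYes≗does (m ℕ.<? n)) (dec-false (m ℕ.<? n) (ℕ.≤⇒≯ n≤m))

AllPairs-++⁻ˡ : ∀ {a ℓ} {A : Set a} {R : Rel A ℓ} xs {ys} → AllPairs R (xs ++ ys) → AllPairs R xs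
AllPairs-++⁻ˡ []       _          = []
AllPairs-++⁻ˡ (x ∷ xs) (px ∷ pxs) = All.++⁻ˡ xs px ∷ AllPairs-++⁻ˡ xs pxs

AllPairs-++⁻ʳ : ∀ {a ℓ} {A : Set a} {R : Rel A ℓ} xs {ys} → AllPairs R (xs ++ ys) → AllPairs R ys
AllPairs-++⁻ʳ []       pys       = pys
AllPairs-++⁻ʳ (x ∷ xs) (_ ∷ pxs) = AllPairs-++⁻ʳ xs pxs

record MinSplit (w L : List ℤ) (m : ℤ) (R : List ℤ) : Set where
  field
    split   : w ≡ L ++ m ∷ R
    below-L : All (m <ₐ_) L
    below-R : All (m <ₐ_) R

splitMin-minSplit : ∀ x xs {L m R} → AllPairs _≉_ (x ∷ xs) →
                    splitMin x xs ≡ (L , m , R) → MinSplit (x ∷ xs) L m R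
splitMin-minSplit x []       _ refl = record { split = refl ; below-L = [] ; below-R = [] }
splitMin-minSplit x (y ∷ ys) (_ ∷ d) eq with splitMin y ys in eq′
... | L , m , R with splitMin-minSplit y ys d eq′ | ∣ x ∣ ℕ.<? ∣ m ∣
splitMin-minSplit x (y ∷ ys) _ refl | L , m , R | s | yes x<m =
  record { split = refl ; below-L = [] ; below-R = subst (All (x <ₐ_)) (sym split) x<L++m∷R }
  where
  open MinSplit s
  x<L++m∷R : All (x <ₐ_) (L ++ m ∷ R)
  x<L++m∷R = All.++⁺ (All.map (ℕ.<-trans x<m) below-L) (x<m ∷ All.map (ℕ.<-trans x<m) below-R)
splitMin-minSplit x (y ∷ ys) (x≉ ∷ _) refl | L , m , R | s | no x≮m =
  record { split = cong (x ∷_) split ; below-L = m<x ∷ below-L ; below-R = below-R }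
  where
  open MinSplit s
  x≉m : x ≉ m
  x≉m = All.head (All.++⁻ʳ L (subst (All (x ≉_)) split x≉))
  m<x : m <ₐ x
  m<x = ℕ.≤∧≢⇒< (ℕ.≮⇒≥ x≮m) (λ e → x≉m (sym e))

-- spkGo p w counts the signed peaks of w when w is preceded by a letter of absolute value p;
-- lastAbs p w is that state after reading w.
lastAbs : ℕ → List ℤ → ℕ
lastAbs p []       = p
lastAbs p (x ∷ xs) = lastAbs ∣ x ∣ xs

lastAbs-above : ∀ z p x xs → All (z <ₐ_) (x ∷ xs) → ∣ z ∣ ℕ.< lastAbs p (x ∷ xs)
lastAbs-above z p x []        (z<x ∷ _) = z<x
lastAbs-above z p x (x′ ∷ xs) (_ ∷ z<)  = lastAbs-above z ∣ x ∣ x′ xs z<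

spkGo-prev-irrelevant : ∀ {p p′} y ys → p ℕ.< ∣ y ∣ → p′ ℕ.< ∣ y ∣ →
                        spkGo p (y ∷ ys) ≡ spkGo p′ (y ∷ ys)
spkGo-prev-irrelevant y ys p<y p′<y rewrite <ᵇ-true p<y | <ᵇ-true p′<y = refl

spk-after-valley : ∀ z R → All (z <ₐ_) R → spkGo ∣ z ∣ R ≡ spk R
spk-after-valley z []      _         = refl
spk-after-valley z (r ∷ R) (z<r ∷ _) = spkGo-prev-irrelevant r R z<r (ℕ.≤-<-trans z≤n z<r)

spkGo-++-valley : ∀ p L z R → All (z <ₐ_) L →
                  spkGo p (L ++ z ∷ R) ≡ spkGo p L ℕ.+ spkGo (lastAbs p L) (z ∷ R)
spkGo-++-valley p []           z R _ = refl
spkGo-++-valley p (x ∷ [])     z R (z<x ∷ _)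
  rewrite <ᵇ-true z<x | <ᵇ-true (ℕ.≤-<-trans z≤n z<x)
        | ℕ.+-identityʳ (if isNeg x ∧ (p <ᵇ ∣ x ∣) ∧ true then 1 else 0) = refl
spkGo-++-valley p (x ∷ x′ ∷ L) z R (_ ∷ z<L) rewrite spkGo-++-valley ∣ x ∣ (x′ ∷ L) z R z<L =
  sym (ℕ.+-assoc (if isNeg x ∧ (p <ᵇ ∣ x ∣) ∧ (∣ x′ ∣ <ᵇ ∣ x ∣) then 1 else 0) _ _)

spkGo-not-peak : ∀ p z R → ∣ z ∣ ≤ p ⊎ ∣ z ∣ ≤ nextAbs R → spkGo p (z ∷ R) ≡ spkGo ∣ z ∣ R
spkGo-not-peak p z R (inj₁ z≤p) rewrite <ᵇ-false z≤p =
  cong (λ b → (if b then 1 else 0) ℕ.+ spkGo ∣ z ∣ R) (∧-zeroʳ (isNeg z))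
spkGo-not-peak p z R (inj₂ z≤next) rewrite <ᵇ-false z≤next =
  cong (λ b → (if b then 1 else 0) ℕ.+ spkGo ∣ z ∣ R)
       (trans (cong (isNeg z ∧_) (∧-zeroʳ (p <ᵇ ∣ z ∣))) (∧-zeroʳ (isNeg z)))

spk-++-valley : ∀ L z R → All (z <ₐ_) L → All (z <ₐ_) R → ¬ (L ≡ [] × R ≡ []) →
                spk (L ++ z ∷ R) ≡ spk L ℕ.+ spk R
spk-++-valley []      z []      _   _         nonempty = ⊥-elim (nonempty (refl , refl))
spk-++-valley []      z (r ∷ R) _   z<R       _        = begin
  spkGo 0 (z ∷ r ∷ R)  ≡⟨ spkGo-not-peak 0 z (r ∷ R) (inj₂ (ℕ.<⇒≤ (All.head z<R))) ⟩
  spkGo ∣ z ∣ (r ∷ R)  ≡⟨ spk-after-valley z (r ∷ R) z<R ⟩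
  spk (r ∷ R)          ∎
  where open ≡-Reasoning
spk-++-valley (l ∷ L) z R       z<L z<R       _        = begin
  spkGo 0 (l ∷ L ++ z ∷ R)                           ≡⟨ spkGo-++-valley 0 (l ∷ L) z R z<L ⟩
  spk (l ∷ L) ℕ.+ spkGo (lastAbs 0 (l ∷ L)) (z ∷ R)  ≡⟨ cong (spk (l ∷ L) ℕ.+_) (spkGo-not-peak _ z R
                                                          (inj₁ (ℕ.<⇒≤ (lastAbs-above z 0 l L z<L)))) ⟩
  spk (l ∷ L) ℕ.+ spkGo ∣ z ∣ R                      ≡⟨ cong (spk (l ∷ L) ℕ.+_) (spk-after-valley z R z<R) ⟩
  spk (l ∷ L) ℕ.+ spk R                              ∎
  where open ≡-Reasoning

EmpSpkBalanced : Tree → List ℤ → Set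
EmpSpkBalanced t w = emp t ℕ.+ 2 * spk w ≡ suc (length w)

-- The node τ builds at a letter of sign b whose neighbouring segments are compared by c.
orientedNode : Bool → Bool → ℕ → Tree → Tree → Tree
orientedNode b c k A B = if b then (if c then node k A B else node k B A)
                              else (if c then node k B A else node k A B)

emp-orientedNode : ∀ b c k A B → emp (orientedNode b c k A B) ≡ emp A ℕ.+ emp B
emp-orientedNode true  true  k A B = refl
emp-orientedNode true  false k A B = ℕ.+-comm (emp B) (emp A)
emp-orientedNode false true  k A B = ℕ.+-comm (emp B) (emp A)
emp-orientedNode false false k A B = refl

balanced-singleton : ∀ f m → NonZeroAbs m → EmpSpkBalanced (tauF (suc f) (m ∷ [])) (m ∷ [])
balanced-singleton f +[1+ _ ] _  = refl
balanced-singleton f -[1+ _ ] _  = refl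
balanced-singleton f (+ zero) m≠0 = ⊥-elim (m≠0 refl)

balanced-node : ∀ t tL tR L m R → All (m <ₐ_) L → All (m <ₐ_) R → ¬ (L ≡ [] × R ≡ []) →
                emp t ≡ emp tL ℕ.+ emp tR →
                EmpSpkBalanced tL L → EmpSpkBalanced tR R → EmpSpkBalanced t (L ++ m ∷ R)
balanced-node t tL tR L m R m<L m<R nonempty emp-t balanced-L balanced-R = begin
  emp t ℕ.+ 2 * spk (L ++ m ∷ R)
    ≡⟨ cong₂ (λ e s → e ℕ.+ 2 * s) emp-t (spk-++-valley L m R m<L m<R nonempty) ⟩
  (emp tL ℕ.+ emp tR) ℕ.+ 2 * (spk L ℕ.+ spk R)
    ≡⟨ cong ((emp tL ℕ.+ emp tR) ℕ.+_) (ℕ.*-distribˡ-+ 2 (spk L) (spk R)) ⟩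
  (emp tL ℕ.+ emp tR) ℕ.+ (2 * spk L ℕ.+ 2 * spk R)
    ≡⟨ interchange (emp tL) (emp tR) (2 * spk L) (2 * spk R) ⟩
  (emp tL ℕ.+ 2 * spk L) ℕ.+ (emp tR ℕ.+ 2 * spk R)
    ≡⟨ cong₂ ℕ._+_ balanced-L balanced-R ⟩
  suc (length L ℕ.+ suc (length R))
    ≡⟨ cong suc (sym (List.length-++ L)) ⟩
  suc (length (L ++ m ∷ R)) ∎
  where
  open ≡-Reasoning
  open import Algebra.Properties.CommutativeSemigroup ℕ.+-commutativeSemigroup using (interchange)

DistinctNonzeroAbs : List ℤ → Set
DistinctNonzeroAbs w = AllPairs _≉_ w × All NonZeroAbs w

distinctNonzeroAbs-split : ∀ L m R → DistinctNonzeroAbs (L ++ m ∷ R) →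
                           DistinctNonzeroAbs L × DistinctNonzeroAbs R
distinctNonzeroAbs-split L m R (distinct , nonzero) =
  (AllPairs-++⁻ˡ L distinct , All.++⁻ˡ L nonzero) ,
  (AllPairs.tail (AllPairs-++⁻ʳ L distinct) , All.tail (All.++⁻ʳ L nonzero))

length-split-≤ : ∀ (L : List ℤ) m R {f} → length (L ++ m ∷ R) ≤ suc f → length L ≤ f × length R ≤ f
length-split-≤ L m R {f} fuel = ℕ.≤-trans (ℕ.m≤m+n (length L) (length R)) L+R≤f ,
                                ℕ.≤-trans (ℕ.m≤n+m (length R) (length L)) L+R≤f
  where
  L+R≤f : length L ℕ.+ length R ≤ f
  L+R≤f = ℕ.s≤s⁻¹ (subst (_≤ suc f) (trans (List.length-++ L) (ℕ.+-suc (length L) (length R))) fuel)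

balanced-step : ∀ f L m R {w} → MinSplit w L m R → ¬ (L ≡ [] × R ≡ []) →
  length w ≤ suc f → DistinctNonzeroAbs w →
  (∀ v → length v ≤ f → DistinctNonzeroAbs v → EmpSpkBalanced (tauF f v) v) →
  EmpSpkBalanced (orientedNode (isPos m) (minLt L R) ∣ m ∣ (tauF f L) (tauF f R)) w
balanced-step f L m R s nonempty fuel distinct-nonzero ih =
  subst (EmpSpkBalanced t) (sym split)
    (balanced-node t (tauF f L) (tauF f R) L m R below-L below-R nonempty
      (emp-orientedNode (isPos m) (minLt L R) ∣ m ∣ (tauF f L) (tauF f R))
      (ih L (proj₁ fuel-LR) (proj₁ distinct-nonzero-LR)) (ih R (proj₂ fuel-LR) (proj₂ distinct-nonzero-LR)))
  where
  open MinSplit s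
  t : Tree
  t = orientedNode (isPos m) (minLt L R) ∣ m ∣ (tauF f L) (tauF f R)
  fuel-LR : length L ≤ f × length R ≤ f
  fuel-LR = length-split-≤ L m R (subst (λ v → length v ≤ suc f) split fuel)
  distinct-nonzero-LR : DistinctNonzeroAbs L × DistinctNonzeroAbs R
  distinct-nonzero-LR = distinctNonzeroAbs-split L m R (subst DistinctNonzeroAbs split distinct-nonzero)

tauF-balanced : ∀ f w → length w ≤ f → DistinctNonzeroAbs w → EmpSpkBalanced (tauF f w) w
tauF-balanced f       []       _  _ = refl
tauF-balanced zero    (x ∷ xs) () _
tauF-balanced (suc f) (x ∷ xs) fuel distinct-nonzero@(distinct , nonzero) with splitMin x xs in eq
... | [] , m , [] = subst (EmpSpkBalanced (tauF (suc f) (m ∷ []))) (sym split)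
                      (balanced-singleton f m (All.head (subst (All NonZeroAbs) split nonzero)))
  where open MinSplit (splitMin-minSplit x xs distinct eq)
... | [] , m , R@(_ ∷ _) = balanced-step f [] m R (splitMin-minSplit x xs distinct eq)
                             (λ { (_ , ()) }) fuel distinct-nonzero (tauF-balanced f)
... | L@(_ ∷ _) , m , R = balanced-step f L m R (splitMin-minSplit x xs distinct eq)
                            (λ { (() , _) }) fuel distinct-nonzero (tauF-balanced f)

IsSignedPerm⇒length : ∀ {n σ} → IsSignedPerm n σ → length σ ≡ n
IsSignedPerm⇒length {n} {σ} σ↭ = begin
  length σ                  ≡⟨ List.length-map ∣_∣ σ ⟨
  length (map ∣_∣ σ)        ≡⟨ ↭-length σ↭ ⟩
  length (map suc (upTo n)) ≡⟨ List.length-map suc (upTo n) ⟩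
  length (upTo n)           ≡⟨ List.length-upTo n ⟩
  n                         ∎
  where open ≡-Reasoning

IsSignedPerm⇒DistinctNonzeroAbs : ∀ {n σ} → IsSignedPerm n σ → DistinctNonzeroAbs σ
IsSignedPerm⇒DistinctNonzeroAbs {n} {σ} σ↭ = AllPairs.map⁻ distinct , All.map⁻ nonzero
  where
  distinct : AllPairs _≢_ (map ∣_∣ σ)
  distinct = Perm.Unique-resp-↭ (setoid ℕ) (↭⇒↭ₛ (↭-sym σ↭))
               (Unique.map⁺ ℕ.suc-injective (Unique.upTo⁺ n))
  nonzero : All (_≢ 0) (map ∣_∣ σ)
  nonzero = All-resp-↭ (↭-sym σ↭) (All.map⁺ (All.universal (λ _ ()) (upTo n)))

m+n≡1+o⇒m≡o-n+1 : ∀ m n o → m ℕ.+ n ≡ suc o → + m ≡ (+ o - + n) + + 1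
m+n≡1+o⇒m≡o-n+1 m n o m+n≡1+o = begin
  + m                    ≡⟨ i≡i+j-j (+ m) (+ n) ⟩
  (+ m + + n) - + n      ≡⟨ cong (λ k → + k - + n) (trans m+n≡1+o (ℕ.+-comm 1 o)) ⟩
  (+ o + + 1) - + n      ≡⟨ i+k-j≡i-j+k (+ o) (+ n) (+ 1) ⟩
  (+ o - + n) + + 1      ∎
  where
  open ≡-Reasoning
  open ℤ-Ring using (solve-∀)
  i≡i+j-j : ∀ i j → i ≡ (i + j) - j
  i≡i+j-j = solve-∀
  i+k-j≡i-j+k : ∀ i j k → (i + k) - j ≡ (i - j) + k
  i+k-j≡i-j+k = solve-∀

lemma7p2 : (n : ℕ) (σ : List ℤ) → IsSignedPerm n σ
    → (+ 0 < smax σ) ⊎ (smax σ < + 0)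
    → + emp (phiF σ) ≡ (+ n - + (2 * spk σ)) + + 1
lemma7p2 n σ σ↭ _ = m+n≡1+o⇒m≡o-n+1 (emp (phiF σ)) (2 * spk σ) n
  (trans (tauF-balanced (length σ) σ ℕ.≤-refl (IsSignedPerm⇒DistinctNonzeroAbs σ↭))
         (cong suc (IsSignedPerm⇒length σ↭)))
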